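{- Let $R$ be an integral domain, let $P,Q\in R$ with $Q\in R^{\times}$, let $f(t)=t^2-Pt+Q$ with roots $\theta_1,\theta_2$ in an algebraic closure of the fraction field of $R$, and assume $d:=P^2-4Q\neq 0$. Let $\mathscr{S}(f,R)^{\times}$ be the set of sequences $(w_n)_{n\in\mathbb Z}$ of elements of $R$ satisfying $w_{n+2}-Pw_{n+1}+Qw_n=0$ for all $n\in\mathbb Z$ and $\Lambda(w_1,w_0):=w_1^2-Pw_0w_1+Qw_0^2\in R^{\times}$, equipped with Laxton's product: for ${\bf w}=(w_n)$, ${\bf v}=(v_n)$ write $w_n=\frac{A\theta_1^n-B\theta_2^n}{\theta_1-\theta_2}$, $v_n=\frac{C\theta_1^n-D'\theta_2^n}{\theta_1-\theta_2}$ with $A=w_1-w_0\theta_2$, $B=w_1-w_0\theta_1$, $C=v_1-v_0\theta_2$, $D'=v_1-v_0\theta_1$, and set ${\bf w}\times{\bf v}=(u_n)$ with $u_n=\frac{AC\theta_1^n-BD'\theta_2^n}{\theta_1-\theta_2}$. Let $V_f(R)^{\times}=\{(a_1,a_0)^T\in R^2:\Lambda(a_1,a_0)\in R^{\times}\}$ and $\mathcal O_R=R[t]/(f(t))$. Then the maps $$\mathscr{S}(f,R)^{\times}\xrightarrow{\phi_R}V_f(R)^{\times}\xrightarrow{\varphi_R}\mathcal O_R^{\times},\qquad (w_n)\mapsto (w_1,w_0)^T\mapsto w_1-w_0t \bmod f(t),$$ are bijections, and Laxton's group structure on $\mathscr{S}(f,R)^{\times}$ coincides with the one transported from the multiplicative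 group $\mathcal O_R^{\times}$ via these maps. Moreover, with $\mathcal B=\begin{pmatrix}P&-Q\\1&0\end{pmatrix}\in \mathrm{GL}_2(R)$, these group isomorphisms are compatible with the following actions of $\langle\mathcal B\rangle$: (i) on $\mathscr{S}(f,R)^{\times}$, $\mathcal B^{\nu}.(w_n)=(v_n)$ with $v_n=w_{n+\nu}$ for all $n$; (ii) on $V_f(R)^{\times}$, $\mathcal B^{\nu}.(w_1,w_0)^T=\mathcal B^{\nu}(w_1,w_0)^T$ (matrix product); (iii) on $\mathcal O_R^{\times}$, $\mathcal B^{\nu}.(w_1-w_0t)=(P-t)^{\nu}(w_1-w_0t)$, for all $\nu\in\mathbb Z$.
   Context: Laxton's product is defined via division by $\theta_1-\theta_2$; in terms of initial terms it reads $u_1=w_1v_1-Qw_0v_0$, $u_0=w_0v_1+w_1v_0-Pw_0v_0$. -}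

module Defs where

open import Level using (_⊔_)
open import Algebra.Bundles using (CommutativeRing)
open import Data.Nat using (ℕ; zero; suc)
open import Data.Integer as ℤ using (ℤ; +_; -[1+_])
open import Data.Product using (Σ; _×_; _,_; proj₁; proj₂)
open import Data.Sum using (_⊎_)
open import Relation.Nullary using (¬_)

module Setup {c ℓ} (R : CommutativeRing c ℓ) where
  open CommutativeRing R hiding (_-_)

  infixl 6 _−_
  _−_ : Carrier → Carrier → Carrier
  x − y = x + (- y)

  IsUnit : Carrier → Set (c ⊔ ℓ)
  IsUnit x = Σ Carrier λ y → (y * x) ≈ 1#

  IsIntegralDomain : Set (c ⊔ ℓ)
  IsIntegralDomain = (¬ (1# ≈ 0#)) × (∀ x y → (x * y) ≈ 0# → (x ≈ 0#) ⊎ (y ≈ 0#))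

  -- f(t) = t² - P t + Q, with Qinv a (chosen) inverse of Q
  module Lax (P Q Qinv : Carrier) where

    Λ : Carrier → Carrier → Carrier
    Λ a₁ a₀ = (a₁ * a₁) − (P * a₀ * a₁) + (Q * a₀ * a₀)

    disc : Carrier
    disc = (P * P) − (Q + Q + Q + Q)

    Seq : Set c
    Seq = ℤ → Carrier

    _≈S_ : Seq → Seq → Set ℓ
    w ≈S v = ∀ n → w n ≈ v n

    IsRec : Seq → Set ℓ
    IsRec w = ∀ n → ((w (n ℤ.+ + 2) − (P * w (n ℤ.+ + 1))) + (Q * w n)) ≈ 0#

    InS× : Seq → Set (c ⊔ ℓ)
    InS× w = IsRec w × IsUnit (Λ (w (+ 1)) (w (+ 0)))

    V : Set c
    V = Carrier × Carrier

    _≈V_ : V → V → Set ℓ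
    (a₁ , a₀) ≈V (b₁ , b₀) = (a₁ ≈ b₁) × (a₀ ≈ b₀)

    InV× : V → Set (c ⊔ ℓ)
    InV× (a₁ , a₀) = IsUnit (Λ a₁ a₀)

    -- 𝒪_R = R[t]/(f(t)), represented in the R-basis {1, t}:
    -- (x , y) stands for x + y t, and t² = P t - Q.
    O : Set c
    O = Carrier × Carrier

    _≈O_ : O → O → Set ℓ
    (x , y) ≈O (x' , y') = (x ≈ x') × (y ≈ y')

    infixl 7 _·O_
    _·O_ : O → O → O
    (x , y) ·O (x' , y') = ((x * x') − (Q * (y * y'))) , (((x * y') + (y * x')) + (P * (y * y')))

    1O : O
    1O = 1# , 0#

    InO× : O → Set (c ⊔ ℓ)
    InO× z = Σ O λ z' → (z' ·O z) ≈O 1O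

    ϕR : Seq → V
    ϕR w = w (+ 1) , w (+ 0)

    φR : V → O
    φR (a₁ , a₀) = a₁ , (- a₀)

    -- The unique sequence satisfying the recurrence with w₁ = a₁, w₀ = a₀
    -- (extended to negative indices using Q⁻¹).
    step : V → V
    step (x₁ , x₀) = ((P * x₁) − (Q * x₀)) , x₁

    back : V → V
    back (x₁ , x₀) = x₀ , (Qinv * ((P * x₀) − x₁))

    iter : (V → V) → ℕ → V → V
    iter g zero a = a
    iter g (suc n) a = g (iter g n a)

    seqFrom : V → Seq
    seqFrom a (+ n) = proj₂ (iter step n a)
    seqFrom a -[1+ n ] = proj₂ (iter back (suc n) a)

    -- Laxton's product, written in terms of initial terms:
    -- u₁ = w₁v₁ - Q w₀v₀,  u₀ = w₀v₁ + w₁v₀ - P w₀v₀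
    laxton : Seq → Seq → Seq
    laxton w v = seqFrom
      ( ((w (+ 1) * v (+ 1)) − (Q * (w (+ 0) * v (+ 0))))
      , (((w (+ 0) * v (+ 1)) + (w (+ 1) * v (+ 0))) − (P * (w (+ 0) * v (+ 0)))) )

    record M2 : Set c where
      constructor mat
      field
        m11 m12 m21 m22 : Carrier

    _⊗_ : M2 → M2 → M2
    mat a b c' d ⊗ mat a' b' c'' d' =
      mat ((a * a') + (b * c'')) ((a * b') + (b * d'))
          ((c' * a') + (d * c'')) ((c' * b') + (d * d'))

    I2 : M2
    I2 = mat 1# 0# 0# 1#

    _▷_ : M2 → V → V
    mat a b c' d ▷ (x₁ , x₀) = ((a * x₁) + (b * x₀)) , ((c' * x₁) + (d * x₀))

    -- ℬ = [[P , -Q] , [1 , 0]] and its inverse Q⁻¹ [[0 , Q] , [-1 , P]]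
    ℬ : M2
    ℬ = mat P (- Q) 1# 0#

    ℬinv : M2
    ℬinv = mat 0# 1# (- Qinv) (Qinv * P)

    matPow : M2 → ℕ → M2
    matPow M zero = I2
    matPow M (suc n) = M ⊗ matPow M n

    ℬ^ : ℤ → M2
    ℬ^ (+ n) = matPow ℬ n
    ℬ^ -[1+ n ] = matPow ℬinv (suc n)

    -- P - t ∈ 𝒪_R and its inverse Q⁻¹ t
    Pt : O
    Pt = P , (- 1#)

    Ptinv : O
    Ptinv = 0# , Qinv

    opow : O → ℕ → O
    opow z zero = 1O
    opow z (suc n) = z ·O opow z n

    Pt^ : ℤ → O
    Pt^ (+ n) = opow Pt n
    Pt^ -[1+ n ] = opow Ptinv (suc n)

    shift : ℤ → Seq → Seq
    shift ν w n = w (n ℤ.+ ν)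

{-# OPTIONS --safe #-}
-- To (a₁, a₀) attach a₁ − a₀ t ∈ 𝒪 = R[t]/(f). Then Λ(a₁, a₀) is the norm of a₁ − a₀ t, where
-- N(x + y t) = x² + P x y + Q y² is multiplicative; hence (a₁, a₀) ∈ V^× exactly when a₁ − a₀ t is a
-- unit of 𝒪, whose inverse is its conjugate divided by its norm. In initial terms Laxton's product
-- is multiplication in 𝒪, and ℬ acts on V as multiplication by P − t, of norm Q, a unit. A solution
-- of the recurrence is determined by two consecutive terms, and moving the window (w_{n+1}, w_n)
-- one step forward or back is applying ℬ or ℬ⁻¹: this gives both the injectivity of ϕ_R and the
-- compatibility of the shift with the ℬ-action.
module Submission where

open import Defs
open import Algebra.Bundles using (CommutativeRing)
open import Data.Integer as ℤ using (ℤ; +_; -[1+_]; _⊖_; _◃_)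
import Data.Integer.Properties as ℤ
open import Data.Maybe as Maybe using (Maybe)
open import Data.Nat as ℕ using (zero; suc)
import Data.Nat.Properties as ℕ
open import Data.Product using (Σ; _×_; _,_; proj₁; proj₂)
open import Data.Product.Relation.Binary.Pointwise.NonDependent using (×-setoid)
import Data.Sign as Sign
open import Relation.Binary.Bundles using (Setoid)
open import Relation.Binary.PropositionalEquality as ≡ using (_≡_)
open import Relation.Nullary using (¬_)
open import Relation.Nullary.Decidable using (dec⇒maybe)
open import Algebra.Properties.CommutativeSemigroup ℤ.+-commutativeSemigroup using (xy∙z≈xz∙y)

-- Algebra.Solver.Ring needs a coefficient ring whose equality can be tested; ℤ, mapped into R,
-- serves for every commutative ring.
module ℤ-CoefficientSolver {c ℓ} (R : CommutativeRing c ℓ) where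
  open CommutativeRing R
  open import Algebra.Properties.Semiring.Mult.TCOptimised semiring renaming (_×_ to _·ℕ_)
  open import Algebra.Properties.Ring ring
  open import Algebra.Properties.CommutativeSemigroup +-commutativeSemigroup using (interchange)
  open import Algebra.Solver.Ring.AlmostCommutativeRing
  open import Relation.Binary.Reasoning.Setoid setoid

  -- With the type-checking optimised multiple, fromℤ (+ 1) reduces to 1#, so that `con (+ 1)`
  -- in a solver equation matches a literal 1# of the goal.
  fromℤ : ℤ → Carrier
  fromℤ (+ n)    = n ·ℕ 1#
  fromℤ -[1+ n ] = - (suc n ·ℕ 1#)

  +-cancelˡ-difference : ∀ x y z → (x + y) - (x + z) ≈ y - z
  +-cancelˡ-difference x y z = begin
    (x + y) + - (x + z)     ≈⟨ +-congˡ (-‿+-comm x z) ⟨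
    (x + y) + (- x + - z)   ≈⟨ interchange x y (- x) (- z) ⟩
    (x + - x) + (y + - z)   ≈⟨ +-congʳ (-‿inverseʳ x) ⟩
    0# + (y - z)            ≈⟨ +-identityˡ (y - z) ⟩
    y - z                   ∎

  -x*-y≈x*y : ∀ x y → (- x) * (- y) ≈ x * y
  -x*-y≈x*y x y = begin
    (- x) * (- y)   ≈⟨ -‿distribˡ-* x (- y) ⟨
    - (x * - y)     ≈⟨ -‿cong (-‿distribʳ-* x y) ⟨
    - - (x * y)     ≈⟨ -‿involutive (x * y) ⟩
    x * y           ∎

  fromℤ-⊖ : ∀ m n → fromℤ (m ⊖ n) ≈ m ·ℕ 1# - n ·ℕ 1#
  fromℤ-⊖ m       zero    = sym (trans (+-congˡ -0#≈0#) (+-identityʳ _))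
  fromℤ-⊖ zero    (suc n) = sym (+-identityˡ _)
  fromℤ-⊖ (suc m) (suc n) = begin
    fromℤ (suc m ⊖ suc n)          ≡⟨ ≡.cong fromℤ (ℤ.[1+m]⊖[1+n]≡m⊖n m n) ⟩
    fromℤ (m ⊖ n)                  ≈⟨ fromℤ-⊖ m n ⟩
    m ·ℕ 1# - n ·ℕ 1#              ≈⟨ +-cancelˡ-difference 1# _ _ ⟨
    (1# + m ·ℕ 1#) - (1# + n ·ℕ 1#) ≈⟨ +-cong (1+× m 1#) (-‿cong (1+× n 1#)) ⟨
    suc m ·ℕ 1# - suc n ·ℕ 1#      ∎

  fromℤ-pos◃ : ∀ n → fromℤ (Sign.+ ◃ n) ≈ n ·ℕ 1#
  fromℤ-pos◃ zero    = refl
  fromℤ-pos◃ (suc n) = refl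

  fromℤ-neg◃ : ∀ n → fromℤ (Sign.- ◃ n) ≈ - (n ·ℕ 1#)
  fromℤ-neg◃ zero    = sym -0#≈0#
  fromℤ-neg◃ (suc n) = refl

  fromℤ-+ : ∀ i j → fromℤ (i ℤ.+ j) ≈ fromℤ i + fromℤ j
  fromℤ-+ (+ m)    (+ n)    = ×-homo-+ 1# m n
  fromℤ-+ (+ m)    -[1+ n ] = fromℤ-⊖ m (suc n)
  fromℤ-+ -[1+ m ] (+ n)    = trans (fromℤ-⊖ n (suc m)) (+-comm _ _)
  fromℤ-+ -[1+ m ] -[1+ n ] = begin
    - (suc (suc (m ℕ.+ n)) ·ℕ 1#)     ≡⟨ ≡.cong (λ k → - (suc k ·ℕ 1#)) (ℕ.+-suc m n) ⟨
    - ((suc m ℕ.+ suc n) ·ℕ 1#)       ≈⟨ -‿cong (×-homo-+ 1# (suc m) (suc n)) ⟩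
    - (suc m ·ℕ 1# + suc n ·ℕ 1#)     ≈⟨ -‿+-comm _ _ ⟨
    - (suc m ·ℕ 1#) + - (suc n ·ℕ 1#) ∎

  fromℤ-* : ∀ i j → fromℤ (i ℤ.* j) ≈ fromℤ i * fromℤ j
  fromℤ-* (+ m)    (+ n)    = trans (fromℤ-pos◃ (m ℕ.* n)) (×1-homo-* m n)
  fromℤ-* (+ m)    -[1+ n ] = trans (fromℤ-neg◃ (m ℕ.* suc n))
    (trans (-‿cong (×1-homo-* m (suc n))) (-‿distribʳ-* _ _))
  fromℤ-* -[1+ m ] (+ n)    = trans (fromℤ-neg◃ (suc m ℕ.* n))
    (trans (-‿cong (×1-homo-* (suc m) n)) (-‿distribˡ-* _ _))
  fromℤ-* -[1+ m ] -[1+ n ] = trans (fromℤ-pos◃ (suc m ℕ.* suc n))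
    (trans (×1-homo-* (suc m) (suc n)) (sym (-x*-y≈x*y _ _)))

  fromℤ-neg : ∀ i → fromℤ (ℤ.- i) ≈ - fromℤ i
  fromℤ-neg (+ zero)  = sym -0#≈0#
  fromℤ-neg (+ suc n) = refl
  fromℤ-neg -[1+ n ]  = sym (-‿involutive _)

  private
    ACR : AlmostCommutativeRing c ℓ
    ACR = fromCommutativeRing R

    fromℤ-morphism : ℤ.+-*-rawRing -Raw-AlmostCommutative⟶ ACR
    fromℤ-morphism = record
      { ⟦_⟧ = fromℤ ; +-homo = fromℤ-+ ; *-homo = fromℤ-* ; -‿homo = fromℤ-neg
      ; 0-homo = refl ; 1-homo = refl }

    fromℤ-≟ : ∀ i j → Maybe (fromℤ i ≈ fromℤ j)
    fromℤ-≟ i j = Maybe.map (λ i≡j → reflexive (≡.cong fromℤ i≡j)) (dec⇒maybe (i ℤ.≟ j))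

  open import Algebra.Solver.Ring ℤ.+-*-rawRing ACR fromℤ-morphism fromℤ-≟ public

module Laxton {c ℓ} (R : CommutativeRing c ℓ) (P Q Qinv : CommutativeRing.Carrier R)
  (Qinv*Q≈1 : CommutativeRing._≈_ R (CommutativeRing._*_ R Qinv Q) (CommutativeRing.1# R)) where
  open CommutativeRing R hiding (_-_; zero)
  open Setup R
  open Lax P Q Qinv
  open ℤ-CoefficientSolver R using (Polynomial; solve; _:=_; _:+_; _:*_; :-_; _:-_; con)
  open import Algebra.Properties.Ring ring using (-‿involutive)
  open import Algebra.Properties.Group +-group using (inverseʳ-unique)
  import Relation.Binary.Reasoning.Setoid setoid as ≈-Reasoning
  module R² = Setoid (×-setoid setoid setoid)
  import Relation.Binary.Reasoning.Setoid (×-setoid setoid setoid) as R²-Reasoning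

  IsUnit-resp : ∀ {x y} → x ≈ y → IsUnit x → IsUnit y
  IsUnit-resp x≈y (u , u*x≈1) = u , trans (*-congˡ (sym x≈y)) u*x≈1

  IsUnit-* : ∀ {x y} → IsUnit x → IsUnit y → IsUnit (x * y)
  IsUnit-* {x} {y} (u , u*x≈1) (v , v*y≈1) = u * v , (begin
    (u * v) * (x * y)  ≈⟨ solve 4 (λ u v x y → (u :* v) :* (x :* y) := (u :* x) :* (v :* y)) refl u v x y ⟩
    (u * x) * (v * y)  ≈⟨ *-cong u*x≈1 v*y≈1 ⟩
    1# * 1#            ≈⟨ *-identityˡ 1# ⟩
    1#                 ∎)
    where open ≈-Reasoning

  IsUnit-Q : IsUnit Q
  IsUnit-Q = Qinv , Qinv*Q≈1

  IsUnit-Qinv : IsUnit Qinv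
  IsUnit-Qinv = Q , trans (*-comm Q Qinv) Qinv*Q≈1

  Qinv*[Q*x]≈x : ∀ x → Qinv * (Q * x) ≈ x
  Qinv*[Q*x]≈x x = begin
    Qinv * (Q * x)   ≈⟨ *-assoc Qinv Q x ⟨
    (Qinv * Q) * x   ≈⟨ *-congʳ Qinv*Q≈1 ⟩
    1# * x           ≈⟨ *-identityˡ x ⟩
    x                ∎
    where open ≈-Reasoning

  Q*[Qinv*x]≈x : ∀ x → Q * (Qinv * x) ≈ x
  Q*[Qinv*x]≈x x = trans (solve 3 (λ Q Qinv x → Q :* (Qinv :* x) := Qinv :* (Q :* x)) refl Q Qinv x)
                          (Qinv*[Q*x]≈x x)

  ·O-cong : ∀ {z₁ z₂ z₁' z₂'} → z₁ ≈O z₁' → z₂ ≈O z₂' → (z₁ ·O z₂) ≈O (z₁' ·O z₂')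
  ·O-cong (e₁ , e₀) (f₁ , f₀) =
    +-cong (*-cong e₁ f₁) (-‿cong (*-congˡ (*-cong e₀ f₀))) ,
    +-cong (+-cong (*-cong e₁ f₀) (*-cong e₀ f₁)) (*-congˡ (*-cong e₀ f₀))

  ·O-assoc : ∀ z₁ z₂ z₃ → ((z₁ ·O z₂) ·O z₃) ≈O (z₁ ·O (z₂ ·O z₃))
  ·O-assoc (x , y) (x' , y') (x'' , y'') =
    solve 8 (λ P Q x y x' y' x'' y'' →
      mul₁ Q (mul₁ Q x y x' y') (mul₂ P x y x' y') x'' y''
        := mul₁ Q x y (mul₁ Q x' y' x'' y'') (mul₂ P x' y' x'' y'')) refl P Q x y x' y' x'' y'' ,
    solve 8 (λ P Q x y x' y' x'' y'' →
      mul₂ P (mul₁ Q x y x' y') (mul₂ P x y x' y') x'' y''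
        := mul₂ P x y (mul₁ Q x' y' x'' y'') (mul₂ P x' y' x'' y'')) refl P Q x y x' y' x'' y''
    where
    mul₁ mul₂ : ∀ {n} → Polynomial n → Polynomial n → Polynomial n → Polynomial n → Polynomial n → Polynomial n
    mul₁ Q x y x' y' = (x :* x') :- (Q :* (y :* y'))
    mul₂ P x y x' y' = ((x :* y') :+ (y :* x')) :+ (P :* (y :* y'))

  ·O-identityˡ : ∀ z → (1O ·O z) ≈O z
  ·O-identityˡ (x , y) =
    solve 3 (λ Q x y → con (+ 1) :* x :- Q :* (con (+ 0) :* y) := x) refl Q x y ,
    solve 3 (λ P x y → (con (+ 1) :* y :+ con (+ 0) :* x) :+ P :* (con (+ 0) :* y) := y) refl P x y

  norm : O → Carrier
  norm (x , y) = (x * x + P * x * y) + Q * y * y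

  norm-cong : ∀ {z z'} → z ≈O z' → norm z ≈ norm z'
  norm-cong (e₁ , e₀) = +-cong (+-cong (*-cong e₁ e₁) (*-cong (*-congˡ e₁) e₀)) (*-cong (*-congˡ e₀) e₀)

  norm-·O : ∀ z z' → norm (z ·O z') ≈ norm z * norm z'
  norm-·O (x , y) (x' , y') = solve 6 (λ P Q x y x' y' →
    let N = λ x y → (x :* x :+ P :* x :* y) :+ Q :* y :* y in
    N ((x :* x') :- (Q :* (y :* y'))) (((x :* y') :+ (y :* x')) :+ (P :* (y :* y')))
      := N x y :* N x' y') refl P Q x y x' y'

  norm-1O : norm 1O ≈ 1#
  norm-1O = trans (+-cong (+-cong (*-identityˡ 1#) (zeroʳ _)) (zeroʳ _))
                  (trans (+-identityʳ _) (+-identityʳ 1#))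

  InO×⇒IsUnit-norm : ∀ z → InO× z → IsUnit (norm z)
  InO×⇒IsUnit-norm z (z' , z'z≈1) = norm z' , (begin
    norm z' * norm z  ≈⟨ norm-·O z' z ⟨
    norm (z' ·O z)    ≈⟨ norm-cong z'z≈1 ⟩
    norm 1O           ≈⟨ norm-1O ⟩
    1#                ∎)
    where open ≈-Reasoning

  -- The inverse of x + y t is u ((x + P y) − y t), where u is the inverse of its norm.
  IsUnit-norm⇒InO× : ∀ z → IsUnit (norm z) → InO× z
  IsUnit-norm⇒InO× (x , y) (u , u*N≈1) = (u * (x + P * y) , u * (- y)) ,
    ( trans (solve 5 (λ P Q u x y →
          (u :* (x :+ P :* y)) :* x :- Q :* ((u :* (:- y)) :* y)
            := u :* ((x :* x :+ P :* x :* y) :+ Q :* y :* y)) refl P Q u x y) u*N≈1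
    , solve 5 (λ P Q u x y →
          ((u :* (x :+ P :* y)) :* y :+ (u :* (:- y)) :* x) :+ P :* ((u :* (:- y)) :* y)
            := con (+ 0)) refl P Q u x y )

  φR-cong : ∀ {a b} → a ≈V b → φR a ≈O φR b
  φR-cong (e₁ , e₀) = e₁ , -‿cong e₀

  φR-injective : ∀ a b → φR a ≈O φR b → a ≈V b
  φR-injective (a₁ , a₀) (b₁ , b₀) (e₁ , e₀) =
    e₁ , trans (sym (-‿involutive a₀)) (trans (-‿cong e₀) (-‿involutive b₀))

  φR⁻¹ : O → V
  φR⁻¹ (x , y) = x , - y

  φR-φR⁻¹ : ∀ z → φR (φR⁻¹ z) ≈O z
  φR-φR⁻¹ (x , y) = refl , -‿involutive y

  Λ≈norm∘φR : ∀ a₁ a₀ → Λ a₁ a₀ ≈ norm (φR (a₁ , a₀))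
  Λ≈norm∘φR = solve 4 (λ P Q a₁ a₀ →
    ((a₁ :* a₁) :- (P :* a₀ :* a₁)) :+ (Q :* a₀ :* a₀)
      := (a₁ :* a₁ :+ P :* a₁ :* (:- a₀)) :+ Q :* (:- a₀) :* (:- a₀)) refl P Q

  InV×⇒IsUnit-norm : ∀ a → InV× a → IsUnit (norm (φR a))
  InV×⇒IsUnit-norm (a₁ , a₀) = IsUnit-resp (Λ≈norm∘φR a₁ a₀)

  IsUnit-norm⇒InV× : ∀ a → IsUnit (norm (φR a)) → InV× a
  IsUnit-norm⇒InV× (a₁ , a₀) = IsUnit-resp (sym (Λ≈norm∘φR a₁ a₀))

  InV×-resp : ∀ {a b} → a ≈V b → InV× a → InV× b
  InV×-resp {a} {b} a≈b u =
    IsUnit-norm⇒InV× b (IsUnit-resp (norm-cong (φR-cong a≈b)) (InV×⇒IsUnit-norm a u))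

  InO×⇒InV×-φR⁻¹ : ∀ z → InO× z → InV× (φR⁻¹ z)
  InO×⇒InV×-φR⁻¹ z u = IsUnit-norm⇒InV× (φR⁻¹ z)
    (IsUnit-resp (norm-cong (R².sym (φR-φR⁻¹ z))) (InO×⇒IsUnit-norm z u))

  ▷-cong : ∀ M {a b} → a ≈V b → (M ▷ a) ≈V (M ▷ b)
  ▷-cong (mat m₁₁ m₁₂ m₂₁ m₂₂) (e₁ , e₀) =
    +-cong (*-congˡ e₁) (*-congˡ e₀) , +-cong (*-congˡ e₁) (*-congˡ e₀)

  ⊗-▷ : ∀ M N a → ((M ⊗ N) ▷ a) ≈V (M ▷ (N ▷ a))
  ⊗-▷ (mat m₁₁ m₁₂ m₂₁ m₂₂) (mat n₁₁ n₁₂ n₂₁ n₂₂) (x₁ , x₀) =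
    row m₁₁ m₁₂ , row m₂₁ m₂₂
    where
    row : ∀ a b → (a * n₁₁ + b * n₂₁) * x₁ + (a * n₁₂ + b * n₂₂) * x₀
                ≈ a * (n₁₁ * x₁ + n₁₂ * x₀) + b * (n₂₁ * x₁ + n₂₂ * x₀)
    row a b = solve 8 (λ a b n₁₁ n₁₂ n₂₁ n₂₂ x₁ x₀ →
      (a :* n₁₁ :+ b :* n₂₁) :* x₁ :+ (a :* n₁₂ :+ b :* n₂₂) :* x₀
        := a :* (n₁₁ :* x₁ :+ n₁₂ :* x₀) :+ b :* (n₂₁ :* x₁ :+ n₂₂ :* x₀)) refl a b n₁₁ n₁₂ n₂₁ n₂₂ x₁ x₀

  I2-▷ : ∀ a → (I2 ▷ a) ≈V a
  I2-▷ (x₁ , x₀) =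
    trans (+-cong (*-identityˡ x₁) (zeroˡ x₀)) (+-identityʳ x₁) ,
    trans (+-cong (zeroˡ x₁) (*-identityˡ x₀)) (+-identityˡ x₀)

  ℬ-▷ : ∀ x₁ x₀ → (ℬ ▷ (x₁ , x₀)) ≈V step (x₁ , x₀)
  ℬ-▷ x₁ x₀ =
    solve 4 (λ P Q x₁ x₀ → P :* x₁ :+ (:- Q) :* x₀ := P :* x₁ :- Q :* x₀) refl P Q x₁ x₀ ,
    solve 2 (λ x₁ x₀ → con (+ 1) :* x₁ :+ con (+ 0) :* x₀ := x₁) refl x₁ x₀

  ℬinv-▷ : ∀ x₁ x₀ → (ℬinv ▷ (x₁ , x₀)) ≈V back (x₁ , x₀)
  ℬinv-▷ x₁ x₀ =
    solve 2 (λ x₁ x₀ → con (+ 0) :* x₁ :+ con (+ 1) :* x₀ := x₀) refl x₁ x₀ ,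
    solve 4 (λ P Qinv x₁ x₀ → (:- Qinv) :* x₁ :+ (Qinv :* P) :* x₀ := Qinv :* (P :* x₀ :- x₁)) refl P Qinv x₁ x₀

  φR-ℬ : ∀ a → φR (ℬ ▷ a) ≈O (Pt ·O φR a)
  φR-ℬ (x₁ , x₀) =
    solve 4 (λ P Q x₁ x₀ → P :* x₁ :+ (:- Q) :* x₀ := P :* x₁ :- Q :* ((:- con (+ 1)) :* (:- x₀))) refl P Q x₁ x₀ ,
    solve 3 (λ P x₁ x₀ → :- (con (+ 1) :* x₁ :+ con (+ 0) :* x₀)
      := (P :* (:- x₀) :+ (:- con (+ 1)) :* x₁) :+ P :* ((:- con (+ 1)) :* (:- x₀))) refl P x₁ x₀

  φR-ℬinv : ∀ a → φR (ℬinv ▷ a) ≈O (Ptinv ·O φR a)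
  φR-ℬinv (x₁ , x₀) =
    (begin
      0# * x₁ + 1# * x₀              ≈⟨ solve 2 (λ x₁ x₀ → con (+ 0) :* x₁ :+ con (+ 1) :* x₀
                                                        := con (+ 0) :* x₁ :- (:- x₀)) refl x₁ x₀ ⟩
      0# * x₁ − (- x₀)               ≈⟨ +-congˡ (-‿cong (Q*[Qinv*x]≈x (- x₀))) ⟨
      0# * x₁ − Q * (Qinv * (- x₀))  ∎) ,
    solve 4 (λ P Qinv x₁ x₀ → :- ((:- Qinv) :* x₁ :+ (Qinv :* P) :* x₀)
      := (con (+ 0) :* (:- x₀) :+ Qinv :* x₁) :+ P :* (Qinv :* (:- x₀))) refl P Qinv x₁ x₀
    where open ≈-Reasoning

  φR-matPow : ∀ M z → (∀ a → φR (M ▷ a) ≈O (z ·O φR a)) →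
              ∀ n a → φR (matPow M n ▷ a) ≈O (opow z n ·O φR a)
  φR-matPow M z φR-M zero    a = R².trans (φR-cong (I2-▷ a)) (R².sym (·O-identityˡ (φR a)))
  φR-matPow M z φR-M (suc n) a = begin
    φR ((M ⊗ matPow M n) ▷ a)    ≈⟨ φR-cong (⊗-▷ M (matPow M n) a) ⟩
    φR (M ▷ (matPow M n ▷ a))    ≈⟨ φR-M (matPow M n ▷ a) ⟩
    z ·O φR (matPow M n ▷ a)     ≈⟨ ·O-cong {z} R².refl (φR-matPow M z φR-M n a) ⟩
    z ·O (opow z n ·O φR a)      ≈⟨ ·O-assoc z (opow z n) (φR a) ⟨
    (z ·O opow z n) ·O φR a      ∎
    where open R²-Reasoning

  φR-ℬ^ : ∀ ν a → φR (ℬ^ ν ▷ a) ≈O (Pt^ ν ·O φR a)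
  φR-ℬ^ (+ n)    = φR-matPow ℬ Pt φR-ℬ n
  φR-ℬ^ -[1+ n ] = φR-matPow ℬinv Ptinv φR-ℬinv (suc n)

  IsUnit-norm-opow : ∀ {z} → IsUnit (norm z) → ∀ n → IsUnit (norm (opow z n))
  IsUnit-norm-opow     u zero    = IsUnit-resp (sym norm-1O) (1# , *-identityˡ 1#)
  IsUnit-norm-opow {z} u (suc n) =
    IsUnit-resp (sym (norm-·O z (opow z n))) (IsUnit-* u (IsUnit-norm-opow u n))

  IsUnit-norm-Pt^ : ∀ ν → IsUnit (norm (Pt^ ν))
  IsUnit-norm-Pt^ (+ n)    = IsUnit-norm-opow (IsUnit-resp norm-Pt IsUnit-Q) n
    where
    norm-Pt : Q ≈ norm Pt
    norm-Pt = solve 2 (λ P Q → Q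
      := (P :* P :+ P :* P :* (:- con (+ 1))) :+ Q :* (:- con (+ 1)) :* (:- con (+ 1))) refl P Q
  IsUnit-norm-Pt^ -[1+ n ] =
    IsUnit-norm-opow (IsUnit-resp norm-Ptinv (IsUnit-* (IsUnit-* IsUnit-Q IsUnit-Qinv) IsUnit-Qinv)) (suc n)
    where
    norm-Ptinv : Q * Qinv * Qinv ≈ norm Ptinv
    norm-Ptinv = solve 3 (λ P Q Qinv → Q :* Qinv :* Qinv
      := (con (+ 0) :* con (+ 0) :+ P :* con (+ 0) :* Qinv) :+ Q :* Qinv :* Qinv) refl P Q Qinv

  InV×-ℬ^ : ∀ ν a → InV× a → InV× (ℬ^ ν ▷ a)
  InV×-ℬ^ ν a u = IsUnit-norm⇒InV× (ℬ^ ν ▷ a) (IsUnit-resp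
    (sym (trans (norm-cong (φR-ℬ^ ν a)) (norm-·O (Pt^ ν) (φR a))))
    (IsUnit-* (IsUnit-norm-Pt^ ν) (InV×⇒IsUnit-norm a u)))

  ϕR-cong : ∀ {w v} → w ≈S v → ϕR w ≈V ϕR v
  ϕR-cong w≈v = w≈v (+ 1) , w≈v (+ 0)

  ϕR-shift-≡ : ∀ w {i j} → i ≡ j → ϕR (shift i w) ≈V ϕR (shift j w)
  ϕR-shift-≡ w i≡j = R².reflexive (≡.cong (λ k → ϕR (shift k w)) i≡j)

  shift-shift : ∀ μ ν w → shift μ (shift ν w) ≈S shift (μ ℤ.+ ν) w
  shift-shift μ ν w n = reflexive (≡.cong w (ℤ.+-assoc n μ ν))

  step-recurrence : ∀ x → (proj₁ (step x) − P * proj₁ x) + Q * proj₂ x ≈ 0#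
  step-recurrence (x₁ , x₀) =
    solve 4 (λ P Q x₁ x₀ → ((P :* x₁ :- Q :* x₀) :- P :* x₁) :+ Q :* x₀ := con (+ 0)) refl P Q x₁ x₀

  back-recurrence : ∀ x → (proj₁ x − P * proj₂ x) + Q * proj₂ (back x) ≈ 0#
  back-recurrence (x₁ , x₀) = begin
    (x₁ − P * x₀) + Q * (Qinv * (P * x₀ − x₁))  ≈⟨ +-congˡ (Q*[Qinv*x]≈x _) ⟩
    (x₁ − P * x₀) + (P * x₀ − x₁)               ≈⟨ solve 2 (λ x y → (x :- y) :+ (y :- x) := con (+ 0)) refl x₁ (P * x₀) ⟩
    0#                                          ∎
    where open ≈-Reasoning

  -- The index -[1+ n ] ℤ.+ + 2 only computes once two constructors of n are exposed.
  seqFrom-IsRec : ∀ a → IsRec (seqFrom a)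
  seqFrom-IsRec a (+ k) rewrite ℕ.+-comm k 2 | ℕ.+-comm k 1 = step-recurrence (iter step k a)
  seqFrom-IsRec a -[1+ 0 ]           = back-recurrence a
  seqFrom-IsRec a -[1+ 1 ]           = back-recurrence (back a)
  seqFrom-IsRec a -[1+ suc (suc k) ] = back-recurrence (iter back (suc (suc k)) a)

  IsRec-shift : ∀ {w} → IsRec w → ∀ ν → IsRec (shift ν w)
  IsRec-shift rec ν n rewrite xy∙z≈xz∙y n (+ 2) ν | xy∙z≈xz∙y n (+ 1) ν = rec (n ℤ.+ ν)

  ϕR-shift-one : ∀ {u} → IsRec u → ϕR (shift (+ 1) u) ≈V (ℬ ▷ ϕR u)
  ϕR-shift-one {u} rec = R².trans (u₂≈ , refl) (R².sym (ℬ-▷ (u (+ 1)) (u (+ 0))))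
    where
    u₂≈ : u (+ 2) ≈ P * u (+ 1) − Q * u (+ 0)
    u₂≈ = begin
      u (+ 2)
        ≈⟨ solve 3 (λ x y z → x := ((x :- y) :+ z) :+ (y :- z)) refl (u (+ 2)) _ _ ⟩
      ((u (+ 2) − P * u (+ 1)) + Q * u (+ 0)) + (P * u (+ 1) − Q * u (+ 0))
        ≈⟨ +-congʳ (rec (+ 0)) ⟩
      0# + (P * u (+ 1) − Q * u (+ 0))
        ≈⟨ +-identityˡ _ ⟩
      P * u (+ 1) − Q * u (+ 0)
        ∎
      where open ≈-Reasoning

  ϕR-shift-minus-one : ∀ {u} → IsRec u → ϕR (shift -[1+ 0 ] u) ≈V (ℬinv ▷ ϕR u)
  ϕR-shift-minus-one {u} rec = R².trans (refl , u₋₁≈) (R².sym (ℬinv-▷ (u (+ 1)) (u (+ 0))))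
    where
    u₋₁≈ : u -[1+ 0 ] ≈ Qinv * (P * u (+ 0) − u (+ 1))
    u₋₁≈ = begin
      u -[1+ 0 ]                        ≈⟨ Qinv*[Q*x]≈x (u -[1+ 0 ]) ⟨
      Qinv * (Q * u -[1+ 0 ])           ≈⟨ *-congˡ (inverseʳ-unique _ _ (rec -[1+ 0 ])) ⟩
      Qinv * - (u (+ 1) − P * u (+ 0))  ≈⟨ *-congˡ (solve 2 (λ x y → :- (x :- y) := y :- x) refl (u (+ 1)) _) ⟩
      Qinv * (P * u (+ 0) − u (+ 1))    ∎
      where open ≈-Reasoning

  ϕR-shift-multiple : ∀ M δ → (∀ {u} → IsRec u → ϕR (shift δ u) ≈V (M ▷ ϕR u)) →
                      ∀ {w} → IsRec w → ∀ m → ϕR (shift (δ ℤ.* + m) w) ≈V (matPow M m ▷ ϕR w)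
  ϕR-shift-multiple M δ ϕR-shift-δ {w} rec zero =
    R².trans (ϕR-shift-≡ w (ℤ.*-zeroʳ δ)) (R².sym (I2-▷ (ϕR w)))
  ϕR-shift-multiple M δ ϕR-shift-δ {w} rec (suc m) = begin
    ϕR (shift (δ ℤ.* + suc m) w)          ≈⟨ ϕR-shift-≡ w (ℤ.*-suc δ (+ m)) ⟩
    ϕR (shift (δ ℤ.+ δ ℤ.* + m) w)        ≈⟨ ϕR-cong (shift-shift δ (δ ℤ.* + m) w) ⟨
    ϕR (shift δ (shift (δ ℤ.* + m) w))    ≈⟨ ϕR-shift-δ (IsRec-shift rec (δ ℤ.* + m)) ⟩
    M ▷ ϕR (shift (δ ℤ.* + m) w)          ≈⟨ ▷-cong M (ϕR-shift-multiple M δ ϕR-shift-δ rec m) ⟩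
    M ▷ (matPow M m ▷ ϕR w)               ≈⟨ ⊗-▷ M (matPow M m) (ϕR w) ⟨
    matPow M (suc m) ▷ ϕR w               ∎
    where open R²-Reasoning

  ϕR-shift : ∀ {w} → IsRec w → ∀ ν → ϕR (shift ν w) ≈V (ℬ^ ν ▷ ϕR w)
  ϕR-shift {w} rec (+ m)    = R².trans (ϕR-shift-≡ w (≡.sym (ℤ.*-identityˡ (+ m))))
                                       (ϕR-shift-multiple ℬ (+ 1) ϕR-shift-one rec m)
  ϕR-shift {w} rec -[1+ m ] = R².trans (ϕR-shift-≡ w (≡.sym (ℤ.-1*i≡-i (+ suc m))))
                                       (ϕR-shift-multiple ℬinv -[1+ 0 ] ϕR-shift-minus-one rec (suc m))

  IsRec-unique : ∀ {w v} → IsRec w → IsRec v → ϕR w ≈V ϕR v → w ≈S v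
  IsRec-unique {w} {v} rw rv w≈v n = begin
    w n                    ≡⟨ ≡.cong w (ℤ.+-identityˡ n) ⟨
    w (+ 0 ℤ.+ n)          ≈⟨ proj₂ (ϕR-shift rw n) ⟩
    proj₂ (ℬ^ n ▷ ϕR w)    ≈⟨ proj₂ (▷-cong (ℬ^ n) w≈v) ⟩
    proj₂ (ℬ^ n ▷ ϕR v)    ≈⟨ proj₂ (ϕR-shift rv n) ⟨
    v (+ 0 ℤ.+ n)          ≡⟨ ≡.cong v (ℤ.+-identityˡ n) ⟩
    v n                    ∎
    where open ≈-Reasoning

  InS×-shift : ∀ {w} → InS× w → ∀ ν → InS× (shift ν w)
  InS×-shift {w} (rec , u) ν =
    IsRec-shift rec ν , InV×-resp (R².sym (ϕR-shift rec ν)) (InV×-ℬ^ ν (ϕR w) u)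

  φR-ϕR-laxton : ∀ w v → φR (ϕR (laxton w v)) ≈O (φR (ϕR w) ·O φR (ϕR v))
  φR-ϕR-laxton w v =
    solve 5 (λ Q w₁ w₀ v₁ v₀ → w₁ :* v₁ :- Q :* (w₀ :* v₀) := w₁ :* v₁ :- Q :* ((:- w₀) :* (:- v₀)))
      refl Q (w (+ 1)) (w (+ 0)) (v (+ 1)) (v (+ 0)) ,
    solve 5 (λ P w₁ w₀ v₁ v₀ → :- ((w₀ :* v₁ :+ w₁ :* v₀) :- P :* (w₀ :* v₀))
      := (w₁ :* (:- v₀) :+ (:- w₀) :* v₁) :+ P :* ((:- w₀) :* (:- v₀)))
      refl P (w (+ 1)) (w (+ 0)) (v (+ 1)) (v (+ 0))

  InS×-laxton : ∀ {w v} → InS× w → InS× v → InS× (laxton w v)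
  InS×-laxton {w} {v} (_ , uw) (_ , uv) = seqFrom-IsRec _ ,
    IsUnit-norm⇒InV× (ϕR (laxton w v)) (IsUnit-resp
      (sym (trans (norm-cong (φR-ϕR-laxton w v)) (norm-·O (φR (ϕR w)) (φR (ϕR v)))))
      (IsUnit-* (InV×⇒IsUnit-norm (ϕR w) uw) (InV×⇒IsUnit-norm (ϕR v) uv)))

theorem3 : ∀ {c ℓ} (R : CommutativeRing c ℓ) →
    Setup.IsIntegralDomain R →
    (P Q Qinv : CommutativeRing.Carrier R) →
    CommutativeRing._≈_ R (CommutativeRing._*_ R Qinv Q) (CommutativeRing.1# R) →
    let open CommutativeRing R
        open Setup R
        open Lax P Q Qinv
    in ¬ (disc ≈ 0#) →
      -- ϕ_R : 𝒮(f,R)^× → V_f(R)^× is well defined and bijective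
      ((∀ w → InS× w → InV× (ϕR w))
      × (∀ w v → InS× w → InS× v → ϕR w ≈V ϕR v → w ≈S v)
      × (∀ a → InV× a → Σ Seq (λ w → InS× w × (ϕR w ≈V a)))
      -- φ_R : V_f(R)^× → 𝒪_R^× is well defined and bijective
      × (∀ a → InV× a → InO× (φR a))
      × (∀ a b → InV× a → InV× b → φR a ≈O φR b → a ≈V b)
      × (∀ z → InO× z → Σ V (λ a → InV× a × (φR a ≈O z)))
      -- Laxton's product is closed on 𝒮^× and corresponds to multiplication in 𝒪_R^×
      × (∀ w v → InS× w → InS× v →
           InS× (laxton w v) × (φR (ϕR (laxton w v)) ≈O (φR (ϕR w) ·O φR (ϕR v))))
      -- compatibility with the ⟨ℬ⟩-actions, for all ν ∈ ℤ
      × (∀ (ν : ℤ) w → InS× w →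
           InS× (shift ν w) × (ϕR (shift ν w) ≈V (ℬ^ ν ▷ ϕR w)))
      × (∀ (ν : ℤ) a → InV× a →
           InV× (ℬ^ ν ▷ a) × (φR (ℬ^ ν ▷ a) ≈O (Pt^ ν ·O φR a))))
-- R being a domain and d ≠ 0 are only needed to divide by θ₁ − θ₂ in the paper; with Laxton's
-- product given by its initial terms the argument does not use them.
theorem3 R _ P Q Qinv Qinv*Q≈1 _ =
    (λ w → proj₂)
  , (λ w v (rw , _) (rv , _) → IsRec-unique rw rv)
  , (λ a u → seqFrom a , (seqFrom-IsRec a , u) , R².refl)
  , (λ a u → IsUnit-norm⇒InO× (φR a) (InV×⇒IsUnit-norm a u))
  , (λ a b _ _ → φR-injective a b)
  , (λ z u → φR⁻¹ z , InO×⇒InV×-φR⁻¹ z u , φR-φR⁻¹ z)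
  , (λ w v sw sv → InS×-laxton sw sv , φR-ϕR-laxton w v)
  , (λ ν w sw → InS×-shift sw ν , ϕR-shift (proj₁ sw) ν)
  , (λ ν a u → InV×-ℬ^ ν a u , φR-ℬ^ ν a)
  where
  open Setup R
  open Lax P Q Qinv
  open Laxton R P Q Qinv Qinv*Q≈1
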